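{- Let $R,c$ be positive integers and let $B$ be a squarefree positive integer with $cB-R\,\partial(B)=1$. Then for every prime $q\mid B$, \[q\ \Big|\ R\,\frac{B}{q}+1.\]
   Context: $\partial$ denotes the arithmetic derivative: $\partial(p)=1$ for primes $p$, $\partial(ab)=a\partial(b)+b\partial(a)$; for squarefree $B$, $\partial(B)=\sum_{p\mid B}B/p$. -}

module Defs where

open import Data.Nat using (ℕ; zero; suc; _*_; _/_)
open import Data.Nat.Divisibility using (_∣_; _∣?_)
open import Data.Nat.Primality using (Prime; prime?)
open import Data.List using (map; upTo)
open import Data.Nat.ListAction using (sum)
open import Data.Empty using (⊥)
open import Relation.Nullary using (yes; no; _×-dec_)

SquareFree : ℕ → Set
SquareFree B = ∀ p → Prime p → p * p ∣ B → ⊥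

derivTerm : ℕ → ℕ → ℕ
derivTerm B k with prime? (suc k) ×-dec (suc k ∣? B)
... | yes _ = B / suc k
... | no _  = 0

-- Arithmetic derivative of a squarefree B, as given in the context:
-- ∂(B) = Σ_{p prime, p ∣ B} B / p   (p ranges over 1..B, which covers all divisors of B > 0).
∂sf : ℕ → ℕ
∂sf B = sum (map (derivTerm B) (upTo B))

{-# OPTIONS --safe #-}
-- For a prime q ∣ B every summand B / p of ∂(B) with p ≠ q is still divisible by q,
-- so ∂(B) ≡ B / q (mod q). As q ∣ cB = R ∂(B) + 1, this gives q ∣ R (B / q) + 1.
module Submission where

open import Defs
open import Data.Nat using (ℕ; zero; suc; _+_; _*_; _/_; _≥_; _<_; NonZero; >-nonZero)
open import Data.Nat.Properties
  using (<-irrefl; m<1+n⇒m<n∨m≡n; n<1+n; m<n⇒m<1+n; suc-injective; +-assoc; +-comm; +-identityʳ; *-distribʳ-+)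
open import Data.Nat.Divisibility
  using (_∣_; _∣?_; divides; _∣0; ∣-trans; n∣m*n; ∣m+n∣m⇒∣n; ∣m∣n⇒∣m+n; ∣⇒≤)
open import Data.Nat.DivMod using (m/n*n≡m)
open import Data.Nat.Primality using (Prime; prime?; euclidsLemma; prime⇒irreducible; ¬prime[0]; ¬prime[1])
open import Data.Nat.Tactic.RingSolver using (solve-∀)
open import Data.List using (map; upTo; [_]; _∷ʳ_)
open import Data.List.Properties using (map-++; upTo-∷ʳ)
open import Data.Nat.ListAction using (sum)
open import Data.Nat.ListAction.Properties using (sum-++)
open import Data.Product using (_,_; ∃-syntax)
open import Data.Sum using (inj₁; inj₂)
open import Function using (_∘_)
open import Relation.Nullary using (¬_; yes; no; _×-dec_; contradiction)
open import Relation.Binary.PropositionalEquality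
  using (_≡_; _≢_; refl; sym; trans; cong; cong₂; subst; module ≡-Reasoning)

sumUpTo : (ℕ → ℕ) → ℕ → ℕ
sumUpTo f n = sum (map f (upTo n))

sumUpTo-suc : ∀ f n → sumUpTo f (suc n) ≡ sumUpTo f n + f n
sumUpTo-suc f n = begin
  sum (map f (upTo (suc n)))           ≡⟨ cong (sum ∘ map f) (upTo-∷ʳ n) ⟨
  sum (map f (upTo n ∷ʳ n))            ≡⟨ cong sum (map-++ f (upTo n) [ n ]) ⟩
  sum (map f (upTo n) ∷ʳ f n)          ≡⟨ sum-++ (map f (upTo n)) [ f n ] ⟩
  sumUpTo f n + (f n + 0)              ≡⟨ cong (sumUpTo f n +_) (+-identityʳ (f n)) ⟩
  sumUpTo f n + f n                    ∎
  where open ≡-Reasoning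

∣-sumUpTo : ∀ {d} f n → (∀ {i} → i < n → d ∣ f i) → d ∣ sumUpTo f n
∣-sumUpTo f zero    _   = _ ∣0
∣-sumUpTo f (suc n) d∣f rewrite sumUpTo-suc f n =
  ∣m∣n⇒∣m+n (∣-sumUpTo f n (d∣f ∘ m<n⇒m<1+n)) (d∣f (n<1+n n))

sumUpTo≡term+multiple : ∀ {d k} f n → k < n → (∀ {i} → i < n → i ≢ k → d ∣ f i) →
                        ∃[ m ] sumUpTo f n ≡ f k + m * d
sumUpTo≡term+multiple f zero () _
sumUpTo≡term+multiple {d} f (suc n) k<1+n d∣f with m<1+n⇒m<n∨m≡n k<1+n
... | inj₂ refl
  with ∣-sumUpTo f n (λ i<n → d∣f (m<n⇒m<1+n i<n) (λ i≡n → <-irrefl i≡n i<n))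
...   | divides m sum≡m*d = m , (begin
  sumUpTo f (suc n)     ≡⟨ sumUpTo-suc f n ⟩
  sumUpTo f n + f n     ≡⟨ cong (_+ f n) sum≡m*d ⟩
  m * d + f n           ≡⟨ +-comm (m * d) (f n) ⟩
  f n + m * d           ∎)
  where open ≡-Reasoning
sumUpTo≡term+multiple {d} {k} f (suc n) k<1+n d∣f | inj₁ k<n
  with sumUpTo≡term+multiple f n k<n (d∣f ∘ m<n⇒m<1+n)
     | d∣f (n<1+n n) (λ n≡k → <-irrefl (sym n≡k) k<n)
... | m , sum≡ | divides t fn≡t*d = m + t , (begin
  sumUpTo f (suc n)         ≡⟨ sumUpTo-suc f n ⟩
  sumUpTo f n + f n         ≡⟨ cong₂ _+_ sum≡ fn≡t*d ⟩
  f k + m * d + t * d       ≡⟨ +-assoc (f k) (m * d) (t * d) ⟩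
  f k + (m * d + t * d)     ≡⟨ cong (f k +_) (*-distribʳ-+ d m t) ⟨
  f k + (m + t) * d         ∎)
  where open ≡-Reasoning

prime∣prime⇒≡ : ∀ {p q} → Prime q → Prime p → q ∣ p → q ≡ p
prime∣prime⇒≡ q-prime p-prime q∣p with prime⇒irreducible p-prime q∣p
... | inj₁ refl = contradiction q-prime ¬prime[1]
... | inj₂ q≡p  = q≡p

prime∣quotient : ∀ {p q B} .{{_ : NonZero p}} → Prime q → q ∣ B → p ∣ B → ¬ q ∣ p → q ∣ B / p
prime∣quotient {p} {q} {B} q-prime q∣B p∣B q∤p
  with euclidsLemma (B / p) p q-prime (subst (q ∣_) (sym (m/n*n≡m p∣B)) q∣B)
... | inj₁ q∣B/p = q∣B/p
... | inj₂ q∣p   = contradiction q∣p q∤p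

derivTerm-prime-divisor : ∀ {B k} → Prime (suc k) → suc k ∣ B → derivTerm B k ≡ B / suc k
derivTerm-prime-divisor {B} {k} p-prime p∣B with prime? (suc k) ×-dec (suc k ∣? B)
... | yes _  = refl
... | no ¬p = contradiction (p-prime , p∣B) ¬p

prime∣derivTerm : ∀ {B k q} → Prime q → q ∣ B → suc k ≢ q → q ∣ derivTerm B k
prime∣derivTerm {B} {k} q-prime q∣B 1+k≢q with prime? (suc k) ×-dec (suc k ∣? B)
... | yes (p-prime , p∣B) =
  prime∣quotient q-prime q∣B p∣B (1+k≢q ∘ sym ∘ prime∣prime⇒≡ q-prime p-prime)
... | no _ = _ ∣0

∂sf≡quotient+multiple : ∀ {B p} → B ≥ 1 → Prime (suc p) → suc p ∣ B →
                        ∃[ m ] ∂sf B ≡ B / suc p + m * suc p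
∂sf≡quotient+multiple {B} B≥1 q-prime q∣B
  with sumUpTo≡term+multiple (derivTerm B) B (∣⇒≤ {{>-nonZero B≥1}} q∣B)
         (λ _ i≢p → prime∣derivTerm q-prime q∣B (i≢p ∘ suc-injective))
... | m , ∂B≡ = m , trans ∂B≡ (cong (_+ m * _) (derivTerm-prime-divisor q-prime q∣B))

mainTheorem8 : (R c B : ℕ) → R ≥ 1 → c ≥ 1 → B ≥ 1 → SquareFree B →
               c * B ≡ R * ∂sf B + 1 →
               (q : ℕ) → .{{_ : NonZero q}} → Prime q → q ∣ B → q ∣ R * (B / q) + 1
mainTheorem8 _ _ _ _ _ _ _ _ zero q-prime _ = contradiction q-prime ¬prime[0]
mainTheorem8 R c B _ _ B≥1 _ cB≡R∂B+1 q@(suc _) q-prime q∣B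
  with ∂sf≡quotient+multiple B≥1 q-prime q∣B
... | m , ∂B≡ = ∣m+n∣m⇒∣n (subst (q ∣_) cB≡ (∣-trans q∣B (n∣m*n c))) (n∣m*n (R * m))
  where
  open ≡-Reasoning
  rearrange : ∀ r x m n → r * (x + m * n) + 1 ≡ r * m * n + (r * x + 1)
  rearrange = solve-∀
  cB≡ : c * B ≡ R * m * q + (R * (B / q) + 1)
  cB≡ = begin
    c * B                          ≡⟨ cB≡R∂B+1 ⟩
    R * ∂sf B + 1                  ≡⟨ cong (λ x → R * x + 1) ∂B≡ ⟩
    R * (B / q + m * q) + 1        ≡⟨ rearrange R (B / q) m q ⟩
    R * m * q + (R * (B / q) + 1)  ∎
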